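{- Let $\alpha=\{a_1,\dots,a_n\}$ be a set of $n$ elements, $\delta<n$ a non-negative integer, and $\Gamma:\alpha\to\{0,1,\dots,n\}$ the mapping with $\Gamma(x)=0$ for all $x$. If the procedure $\mathrm{partition}$ described below is invoked as $\mathrm{partition}(\Gamma,1,1,\delta)$, then every $\delta$-partition of $\alpha$ is identical to some mapping reported by the procedure.
   Context: A total mapping $\Gamma:\alpha\to\{0,1,\dots,n\}$ is a partition of $\alpha$ if $\Gamma(x)\neq0$ for all $x$; it is a $\delta$-partition if moreover every nonempty part $\{x:\Gamma(x)=i\}$ ($i\ge1$) has more than $\delta$ elements. Two partitions $\Gamma_1,\Gamma_2$ are identical if for every $j$ there is $k$ with $\{x:\Gamma_1(x)=j\}=\{x:\Gamma_2(x)=k\}$. Write $N_j=|\{x:\Gamma(x)=j\}|$ for the current $\Gamma$. The recursive procedure $\mathrm{partition}(\Gamma,\rho,i,\delta)$ does the following: (1) set $\Gamma(a_i):=\rho$. (2) Let $\beta=\{j>0:0<N_j\le\delta\}$. (3) If $\beta\neq\emptyset$: let $\mu=\sum_{j\in\beta}(\delta-N_j+1)$; if $\mu>N_0$, return; if $\mu=N_0$, call $\mathrm{partition}(\Gamma,k,i+1,\delta)$ for each $k\in\beta$ in turn, then return. (4) If $i=n$, report $\Gamma$ as a $\delta$-partition and return. (5) Let $m=\max\{\Gamma(a_1),\dots,\Gamma(a_i)\}$; for $k=1,2,\dots,m+1$ in turn call $\mathrm{partition}(\Gamma,k,i+1,\delta)$; then return. When a call returns, the value it assigned to $a_i$ in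 step (1) is reset to $0$, so each recursive call starts from the caller's current mapping. -}

module Defs where

open import Data.Nat using (ℕ; zero; suc; _+_; _∸_; _≤_; _<_; _⊔_; _≡ᵇ_; _<ᵇ_; _≤ᵇ_)
open import Data.Nat.Properties using (_≟_)
open import Data.Bool using (Bool; true; false; if_then_else_; _∧_; not)
open import Data.Fin using (Fin; toℕ)
open import Data.List using (List; []; _∷_; map; filter; filterᵇ; foldr; upTo; concatMap; length; allFin)
open import Data.Nat.ListAction using (sum)
open import Data.Product using (Σ; _×_; ∃-syntax)
open import Relation.Binary.PropositionalEquality using (_≡_)
open import Relation.Nullary using (¬_)

-- The set α = {a₁,…,aₙ} is modelled by Fin n, where the element a_i
-- (1 ≤ i ≤ n) is the Fin n element with toℕ = i - 1.
-- A mapping Γ : α → {0,…,n} is modelled as a function Fin n → ℕ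
-- (the bound Γ x ≤ n is imposed separately where needed).

Mapping : ℕ → Set
Mapping n = Fin n → ℕ

N : ∀ {n} → Mapping n → ℕ → ℕ
N {n} Γ j = length (filter (λ x → Γ x ≟ j) (allFin n))

IsMapping : ∀ {n} → Mapping n → Set
IsMapping {n} Γ = ∀ x → Γ x ≤ n

IsPartition : ∀ {n} → Mapping n → Set
IsPartition Γ = IsMapping Γ × (∀ x → ¬ (Γ x ≡ 0))

IsδPartition : ∀ {n} → ℕ → Mapping n → Set
IsδPartition {n} δ Γ = IsPartition Γ × (∀ i → 1 ≤ i → 0 < N Γ i → δ < N Γ i)

SamePart : ∀ {n} → Mapping n → ℕ → Mapping n → ℕ → Set
SamePart Γ₁ j Γ₂ k = ∀ x → (Γ₁ x ≡ j → Γ₂ x ≡ k) × (Γ₂ x ≡ k → Γ₁ x ≡ j)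

Identical : ∀ {n} → Mapping n → Mapping n → Set
Identical {n} Γ₁ Γ₂ = ∀ j → j ≤ n → ∃[ k ] SamePart Γ₁ j Γ₂ k

-- the list [a , a+1 , … , b]  (empty if b < a)
range : ℕ → ℕ → List ℕ
range a b = map (a +_) (upTo (suc b ∸ a))

set : ∀ {n} → Mapping n → ℕ → ℕ → Mapping n
set Γ i ρ x = if suc (toℕ x) ≡ᵇ i then ρ else Γ x

-- It returns the list of all
-- mappings it reports (in order).  The first argument is fuel that bounds
-- the recursion depth; the procedure is only ever called with i ≤ n, and
-- the initial call uses fuel n, which is always sufficient (each recursive
-- call increases i by one and no call happens at i = n).
-- Since mappings are values, "resetting a_i to 0 on return" is automatic:
-- each recursive call receives the caller's current mapping.
partition : (n fuel : ℕ) → Mapping n → ℕ → ℕ → ℕ → List (Mapping n)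
partition n zero Γ ρ i δ = []
partition n (suc fuel) Γ ρ i δ = step3
  where
  Γ' : Mapping n
  Γ' = set Γ i ρ
  β : List ℕ
  β = filterᵇ (λ j → (0 <ᵇ N Γ' j) ∧ (N Γ' j ≤ᵇ δ)) (range 1 n)
  N₀ : ℕ
  N₀ = N Γ' 0
  μ : ℕ
  μ = sum (map (λ j → δ ∸ N Γ' j + 1) β)
  m : ℕ
  m = foldr _⊔_ 0 (map Γ' (allFin n))
  step5 : List (Mapping n)
  step5 = concatMap (λ k → partition n fuel Γ' k (suc i) δ) (range 1 (suc m))
  step4 : List (Mapping n)
  step4 = if i ≡ᵇ n then Γ' ∷ [] else step5
  nonempty : List ℕ → Bool
  nonempty [] = false
  nonempty (_ ∷ _) = true
  step3 : List (Mapping n)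
  step3 = if nonempty β
          then (if N₀ <ᵇ μ then []
                else if μ ≡ᵇ N₀
                     then concatMap (λ k → partition n fuel Γ' k (suc i) δ) β
                     else step4)
          else step4

Γ₀ : ∀ {n} → Mapping n
Γ₀ _ = 0

reported : (n δ : ℕ) → List (Mapping n)
reported n δ = partition n n Γ₀ 1 1 δ

-- Follow the branch of the search that gives aᵢ₊₁ the label of its Γ-class when that class
-- already occurs among a₁ … aᵢ, and the fresh label m + 1 otherwise; along it the labels induce
-- on a₁ … aᵢ exactly the partition induced by Γ (the invariant Labels).  This branch is never
-- pruned: a label j ∈ β marks a Γ-class with more than δ elements of which only N_j are
-- labelled, so at least δ − N_j + 1 of the N₀ unlabelled elements lie in it, and these sets are
-- disjoint; hence μ ≤ N₀.  When μ = N₀ the unlabelled elements are all used up by those classes,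
-- so aᵢ₊₁ lies in one of them and step (3) recurses on its label.

module Submission where

open import Defs
open import Data.Bool using (Bool; T; T?; true; false; if_then_else_; _∧_)
open import Data.Bool.Properties using (T-∧)
open import Data.Empty using (⊥-elim)
open import Data.Fin using (Fin; toℕ; fromℕ<)
import Data.Fin.Properties as Fin
open import Data.List using (List; []; _∷_; map; filter; filterᵇ; foldr; concatMap; allFin; length)
open import Data.List.Membership.Propositional using (_∈_; find; lose)
open import Data.List.Membership.Propositional.Properties
  using (∈-map⁺; ∈-map⁻; ∈-filter⁻; ∈-allFin; ∈-upTo⁺; ∈-concatMap⁺)
open import Data.List.Properties using (filter-some)
import Data.List.Relation.Unary.All as All
open import Data.List.Relation.Unary.Any as Any using (Any; here; there)
open import Data.List.Relation.Unary.AllPairs using (_∷_)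
open import Data.List.Relation.Unary.Unique.Propositional using (Unique)
import Data.List.Relation.Unary.Unique.Propositional.Properties as Unique
open import Data.Nat using (ℕ; zero; suc; _+_; _∸_; _⊔_; _≤_; _<_; _≤?_; _<?_; _≡ᵇ_; _<ᵇ_; _≤ᵇ_; z≤n; s≤s; s≤s⁻¹)
open import Data.Nat.ListAction using (sum)
open import Data.Nat.Properties
open import Data.Product using (Σ; ∃; ∃-syntax; _×_; _,_; proj₁; proj₂)
open import Data.Sum using (_⊎_; inj₁; inj₂; [_,_])
open import Function using (_∘_; _⇔_; mk⇔; Equivalence)
import Function.Properties.Equivalence as ⇔
open import Level using (0ℓ)
open import Relation.Binary.PropositionalEquality
  using (_≡_; _≢_; refl; sym; trans; cong; subst)
open import Relation.Nullary using (¬_; yes; no; contradiction)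
open import Relation.Nullary.Decidable using (_×-dec_; decidable-stable)
open import Relation.Unary using (Pred; Decidable; _⊆_; _∩_; ∁; _⊥_)
open import Relation.Unary.Properties using (_∪?_; _∩?_; ∁?)

count : {A : Set} {P : Pred A 0ℓ} → Decidable P → List A → ℕ
count P? xs = length (filter P? xs)

module _ {A : Set} {P : Pred A 0ℓ} (P? : Decidable P) where

  count-pos⇒∃ : ∀ xs → 0 < count P? xs → ∃ P
  count-pos⇒∃ (x ∷ xs) pos with P? x
  ... | yes px = x , px
  ... | no _   = count-pos⇒∃ xs pos

  ∈⇒count-pos : ∀ {x xs} → x ∈ xs → P x → 0 < count P? xs
  ∈⇒count-pos x∈xs px = filter-some P? (lose x∈xs px)

module _ {A : Set} {P Q : Pred A 0ℓ} (P? : Decidable P) (Q? : Decidable Q) where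

  count-mono : P ⊆ Q → ∀ xs → count P? xs ≤ count Q? xs
  count-mono P⊆Q [] = z≤n
  count-mono P⊆Q (x ∷ xs) with P? x | Q? x
  ... | yes _ | yes _ = s≤s (count-mono P⊆Q xs)
  ... | yes p | no ¬q = contradiction (P⊆Q p) ¬q
  ... | no _  | yes _ = m≤n⇒m≤1+n (count-mono P⊆Q xs)
  ... | no _  | no _  = count-mono P⊆Q xs

  count-∪ : ∀ xs → count (P? ∪? Q?) xs ≤ count P? xs + count Q? xs
  count-∪ [] = z≤n
  count-∪ (x ∷ xs) with P? x | Q? x
  ... | yes _ | yes _ =
    s≤s (≤-trans (count-∪ xs) (≤-trans (n≤1+n _) (≤-reflexive (sym (+-suc _ _)))))
  ... | yes _ | no _  = s≤s (count-∪ xs)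
  ... | no _  | yes _ = ≤-trans (s≤s (count-∪ xs)) (≤-reflexive (sym (+-suc _ _)))
  ... | no _  | no _  = count-∪ xs

  count-∪-disjoint : P ⊥ Q → ∀ xs → count P? xs + count Q? xs ≤ count (P? ∪? Q?) xs
  count-∪-disjoint P⊥Q [] = z≤n
  count-∪-disjoint P⊥Q (x ∷ xs) with P? x | Q? x
  ... | yes p | yes q = ⊥-elim (P⊥Q (p , q))
  ... | yes _ | no _  = s≤s (count-∪-disjoint P⊥Q xs)
  ... | no _  | yes _ = ≤-trans (≤-reflexive (+-suc _ _)) (s≤s (count-∪-disjoint P⊥Q xs))
  ... | no _  | no _  = count-∪-disjoint P⊥Q xs

sum-map-mono : {B : Set} {f g : B → ℕ} (js : List B) → (∀ {j} → j ∈ js → f j ≤ g j) →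
               sum (map f js) ≤ sum (map g js)
sum-map-mono []       f≤g = z≤n
sum-map-mono (j ∷ js) f≤g = +-mono-≤ (f≤g (here refl)) (sum-map-mono js (f≤g ∘ there))

sum-count-disjoint : {A B : Set} {P : B → Pred A 0ℓ} (P? : ∀ j → Decidable (P j)) →
                     (∀ {j k} → j ≢ k → P j ⊥ P k) →
                     ∀ {Q} (Q? : Decidable Q) (js : List B) → Unique js →
                     (∀ {j} → j ∈ js → P j ⊆ Q) →
                     ∀ xs → sum (map (λ j → count (P? j) xs) js) ≤ count Q? xs
sum-count-disjoint P? disjoint Q? []       _            _   xs = z≤n
sum-count-disjoint {P = P} P? disjoint {Q} Q? (j ∷ js) (j∉js ∷ uniq) P⊆Q xs = begin
    count (P? j) xs + sum (map (λ k → count (P? k) xs) js)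
      ≤⟨ +-monoʳ-≤ (count (P? j) xs)
           (sum-count-disjoint P? disjoint (Q? ∩? ∁? (P? j)) js uniq P⊆Q∖Pj xs) ⟩
    count (P? j) xs + count (Q? ∩? ∁? (P? j)) xs
      ≤⟨ count-∪-disjoint (P? j) (Q? ∩? ∁? (P? j)) (λ (p , _ , ¬p) → ¬p p) xs ⟩
    count (P? j ∪? (Q? ∩? ∁? (P? j))) xs
      ≤⟨ count-mono (P? j ∪? (Q? ∩? ∁? (P? j))) Q? [ P⊆Q (here refl) , proj₁ ] xs ⟩
    count Q? xs ∎
  where
  open ≤-Reasoning
  P⊆Q∖Pj : ∀ {k} → k ∈ js → P k ⊆ Q ∩ ∁ (P j)
  P⊆Q∖Pj k∈js pk = P⊆Q (there k∈js) pk , λ pj → disjoint (All.lookup j∉js k∈js) (pj , pk)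

≤-foldr-⊔ : ∀ {x} xs → x ∈ xs → x ≤ foldr _⊔_ 0 xs
≤-foldr-⊔ (y ∷ xs) (here refl) = m≤m⊔n y _
≤-foldr-⊔ (y ∷ xs) (there x∈xs) = ≤-trans (≤-foldr-⊔ xs x∈xs) (m≤n⊔m y _)

m<n+o⇒m∸n+1≤o : ∀ {m n o} → m < n + o → n ≤ m → m ∸ n + 1 ≤ o
m<n+o⇒m∸n+1≤o {m} {n} {o} m<n+o n≤m = begin
  m ∸ n + 1   ≡⟨ +-comm (m ∸ n) 1 ⟩
  suc (m ∸ n) ≤⟨ ∸-monoˡ-< m<n+o n≤m ⟩
  n + o ∸ n   ≡⟨ m+n∸m≡n n o ⟩
  o           ∎
  where open ≤-Reasoning

∈-range⁺ : ∀ {k b} → 1 ≤ k → k ≤ b → k ∈ range 1 b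
∈-range⁺ {suc k} _ k≤b = ∈-map⁺ (1 +_) (∈-upTo⁺ k≤b)

∈-range⁻ : ∀ {k b} → k ∈ range 1 b → 1 ≤ k
∈-range⁻ k∈range with ∈-map⁻ (1 +_) k∈range
... | _ , _ , refl = s≤s z≤n

range-unique : ∀ b → Unique (range 1 b)
range-unique b = Unique.map⁺ suc-injective (Unique.upTo⁺ b)

set-≡ : ∀ {n} (G : Mapping n) {i} k x → suc (toℕ x) ≡ i → set G i k x ≡ k
set-≡ G {i} k x eq with suc (toℕ x) ≡ᵇ i | ≡⇒≡ᵇ (suc (toℕ x)) i
... | true  | _   = refl
... | false | neq = ⊥-elim (neq eq)

set-≢ : ∀ {n} (G : Mapping n) {i} k x → suc (toℕ x) ≢ i → set G i k x ≡ G x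
set-≢ G {i} k x neq with suc (toℕ x) ≡ᵇ i | ≡ᵇ⇒≡ (suc (toℕ x)) i
... | true  | eq = ⊥-elim (neq (eq _))
... | false | _  = refl

if-elim : {A : Set} (P : A → Set) (b : Bool) {x y : A} →
          (T b → P x) → (¬ T b → P y) → P (if b then x else y)
if-elim P true  onTrue _       = onTrue _
if-elim P false _      onFalse = onFalse (λ ())

concatMap-∈ : {A B : Set} (f : A → List B) {k : A} {ks : List A} {y : B} →
              k ∈ ks → y ∈ f k → y ∈ concatMap f ks
concatMap-∈ f k∈ks y∈fk = ∈-concatMap⁺ f (Any.map (λ { refl → y∈fk }) k∈ks)

module Completeness (n δ : ℕ) (Γ : Mapping n) (Γ-δ : IsδPartition δ Γ) where

  record Labels (G : Mapping n) (i : ℕ) : Set where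
    field
      unlabelled≡0 : ∀ x → i ≤ toℕ x → G x ≡ 0
      labelled≢0   : ∀ x → toℕ x < i → G x ≢ 0
      same-class   : ∀ x y → toℕ x < i → toℕ y < i → (G x ≡ G y) ⇔ (Γ x ≡ Γ y)
  open Labels

  labels-∅ : Labels Γ₀ 0
  labels-∅ = record { unlabelled≡0 = λ _ _ → refl ; labelled≢0 = λ _ () ; same-class = λ _ _ () }

  labels⇒identical : ∀ {G} → Labels G n → Identical Γ G
  labels⇒identical {G} L j _ with Fin.any? (λ x → Γ x ≟ j)
  ... | yes (x , refl) = G x , λ y →
          Equivalence.from (same-class L y x (Fin.toℕ<n y) (Fin.toℕ<n x))
        , Equivalence.to (same-class L y x (Fin.toℕ<n y) (Fin.toℕ<n x))
  ... | no ∄x = 0 , λ y → (λ Γy≡j → ⊥-elim (∄x (y , Γy≡j)))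
                        , (λ Gy≡0 → ⊥-elim (labelled≢0 L y (Fin.toℕ<n y) Gy≡0))

  CorrectLabel : Mapping n → ℕ → Fin n → ℕ → Set
  CorrectLabel G i z k = ∀ w → toℕ w < i → (G w ≡ k) ⇔ (Γ w ≡ Γ z)

  labels-extend : ∀ {G i z k} → Labels G i → toℕ z ≡ i → 1 ≤ k → CorrectLabel G i z k →
                  Labels (set G (suc i) k) (suc i)
  labels-extend {G} {i} {z} {k} L z≡i 1≤k correct = record
    { unlabelled≡0 = λ x i<x → trans (keep x (<⇒≢ i<x ∘ sym)) (unlabelled≡0 L x (<⇒≤ i<x))
    ; labelled≢0   = labelled≢0′
    ; same-class   = same-class′
    }
    where
    H : Mapping n
    H = set G (suc i) k
    new : H z ≡ k
    new = set-≡ G k z (cong suc z≡i)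
    keep : ∀ x → toℕ x ≢ i → H x ≡ G x
    keep x x≢i = set-≢ G k x (x≢i ∘ suc-injective)
    old : ∀ x → toℕ x < i → H x ≡ G x
    old x x<i = keep x (<⇒≢ x<i)
    split : ∀ x → toℕ x < suc i → x ≡ z ⊎ toℕ x < i
    split x x≤i with toℕ x ≟ i
    ... | yes x≡i = inj₁ (Fin.toℕ-injective (trans x≡i (sym z≡i)))
    ... | no x≢i  = inj₂ (≤∧≢⇒< (s≤s⁻¹ x≤i) x≢i)
    labelled≢0′ : ∀ x → toℕ x < suc i → H x ≢ 0
    labelled≢0′ x x≤i with split x x≤i
    ... | inj₁ refl = λ Hz≡0 → <⇒≢ 1≤k (sym (trans (sym new) Hz≡0))
    ... | inj₂ x<i  = labelled≢0 L x x<i ∘ trans (sym (old x x<i))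
    ≡-sym : ∀ {a b : ℕ} → (a ≡ b) ⇔ (b ≡ a)
    ≡-sym = mk⇔ sym sym
    relabel : ∀ {a a′ b b′} {C : Set} → a ≡ a′ → b ≡ b′ → (a′ ≡ b′) ⇔ C → (a ≡ b) ⇔ C
    relabel refl refl e = e
    same-class′ : ∀ x y → toℕ x < suc i → toℕ y < suc i → (H x ≡ H y) ⇔ (Γ x ≡ Γ y)
    same-class′ x y x≤i y≤i with split x x≤i | split y y≤i
    ... | inj₁ refl | inj₁ refl = mk⇔ (λ _ → refl) (λ _ → refl)
    ... | inj₁ refl | inj₂ y<i  = relabel new (old y y<i) (⇔.trans ≡-sym (⇔.trans (correct y y<i) ≡-sym))
    ... | inj₂ x<i  | inj₁ refl = relabel (old x x<i) new (correct x x<i)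
    ... | inj₂ x<i  | inj₂ y<i  = relabel (old x x<i) (old y y<i) (same-class L x y x<i y<i)

  ClassOf : Mapping n → ℕ → ℕ → Pred (Fin n) 0ℓ
  ClassOf G i j x = ∃ λ y → toℕ y < i × G y ≡ j × Γ y ≡ Γ x

  classOf? : ∀ G i j → Decidable (ClassOf G i j)
  classOf? G i j x = Fin.any? (λ y → (toℕ y <? i) ×-dec (G y ≟ j) ×-dec (Γ y ≟ Γ x))

  classOf⇒correct : ∀ {G i j z} → Labels G i → ClassOf G i j z → 1 ≤ j × CorrectLabel G i z j
  classOf⇒correct L (y , y<i , refl , Γy≡Γz) =
      n≢0⇒n>0 (labelled≢0 L y y<i)
    , λ w w<i → subst (λ c → (_ ≡ _) ⇔ (Γ w ≡ c)) Γy≡Γz (same-class L w y w<i y<i)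

  maxLabel : Mapping n → ℕ
  maxLabel G = foldr _⊔_ 0 (map G (allFin n))

  ≤-maxLabel : ∀ G x → G x ≤ maxLabel G
  ≤-maxLabel G x = ≤-foldr-⊔ _ (∈-map⁺ G (∈-allFin x))

  fresh⇒correct : ∀ {G i z} → (∀ y → toℕ y < i → Γ y ≢ Γ z) →
                  CorrectLabel G i z (suc (maxLabel G))
  fresh⇒correct {G} fresh w w<i = mk⇔
    (λ Gw≡max+1 → ⊥-elim (1+n≰n (subst (_≤ maxLabel G) Gw≡max+1 (≤-maxLabel G w))))
    (λ Γw≡Γz → ⊥-elim (fresh w w<i Γw≡Γz))

  choose-label : ∀ {G i} → Labels G i → ∀ z →
                 ∃ λ k → 1 ≤ k × k ≤ suc (maxLabel G) × CorrectLabel G i z k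
  choose-label {G} {i} L z with Fin.any? (λ y → (toℕ y <? i) ×-dec (Γ y ≟ Γ z))
  ... | yes (y , y<i , Γy≡Γz) =
      G y , proj₁ correct , m≤n⇒m≤1+n (≤-maxLabel G y) , proj₂ correct
    where correct = classOf⇒correct L (y , y<i , refl , Γy≡Γz)
  ... | no ∄y =
      suc (maxLabel G) , s≤s z≤n , ≤-refl , fresh⇒correct (λ y y<i Γy≡Γz → ∄y (y , y<i , Γy≡Γz))

  Unlabelled : ℕ → Pred (Fin n) 0ℓ
  Unlabelled i x = i ≤ toℕ x

  unlabelled? : ∀ i → Decidable (Unlabelled i)
  unlabelled? i x = i ≤? toℕ x

  Pending : Mapping n → ℕ → ℕ → Pred (Fin n) 0ℓ
  Pending G i j = Unlabelled i ∩ ClassOf G i j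

  pending? : ∀ G i j → Decidable (Pending G i j)
  pending? G i j = unlabelled? i ∩? classOf? G i j

  pending-disjoint : ∀ {G i j k} → Labels G i → j ≢ k → Pending G i j ⊥ Pending G i k
  pending-disjoint L j≢k ((_ , y , y<i , refl , Γy≡Γx) , (_ , y′ , y′<i , refl , Γy′≡Γx)) =
    j≢k (Equivalence.from (same-class L y y′ y<i y′<i) (trans Γy≡Γx (sym Γy′≡Γx)))

  deficit : Mapping n → ℕ → ℕ
  deficit G j = δ ∸ N G j + 1

  deficit≤pending : ∀ {G i j} → Labels G i → 1 ≤ j → 0 < N G j → N G j ≤ δ →
                    deficit G j ≤ count (pending? G i j) (allFin n)
  deficit≤pending {G} {i} {j} L 1≤j 0<Nj Nj≤δ =
    m<n+o⇒m∸n+1≤o (<-≤-trans class-large class-covered) Nj≤δ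
    where
    y : Fin n
    y = proj₁ (count-pos⇒∃ (λ x → G x ≟ j) (allFin n) 0<Nj)
    Gy≡j : G y ≡ j
    Gy≡j = proj₂ (count-pos⇒∃ (λ x → G x ≟ j) (allFin n) 0<Nj)
    y<i : toℕ y < i
    y<i with i ≤? toℕ y
    ... | yes i≤y = contradiction (trans (sym Gy≡j) (unlabelled≡0 L y i≤y)) (<⇒≢ 1≤j ∘ sym)
    ... | no i≰y  = ≰⇒> i≰y
    class-large : δ < N Γ (Γ y)
    class-large = proj₂ Γ-δ (Γ y) (n≢0⇒n>0 (proj₂ (proj₁ Γ-δ) y))
                    (∈⇒count-pos (λ x → Γ x ≟ Γ y) (∈-allFin y) refl)
    labelled-or-pending : ∀ {x} → Γ x ≡ Γ y → G x ≡ j ⊎ Pending G i j x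
    labelled-or-pending {x} Γx≡Γy with i ≤? toℕ x
    ... | yes i≤x = inj₂ (i≤x , y , y<i , Gy≡j , sym Γx≡Γy)
    ... | no i≰x  = inj₁ (trans (Equivalence.from (same-class L x y (≰⇒> i≰x) y<i) Γx≡Γy) Gy≡j)
    class-covered : N Γ (Γ y) ≤ N G j + count (pending? G i j) (allFin n)
    class-covered = ≤-trans
      (count-mono (λ x → Γ x ≟ Γ y) ((λ x → G x ≟ j) ∪? pending? G i j)
                  labelled-or-pending (allFin n))
      (count-∪ (λ x → G x ≟ j) (pending? G i j) (allFin n))

  -- β, μ and maxLabel repeat the local definitions of Defs.partition verbatim, so that
  -- Call.unfold-[] and Call.unfold-∷ hold by refl.
  β : Mapping n → List ℕ
  β G = filterᵇ (λ j → (0 <ᵇ N G j) ∧ (N G j ≤ᵇ δ)) (range 1 n)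

  μ : Mapping n → ℕ
  μ G = sum (map (deficit G) (β G))

  ∈-β⁻ : ∀ {G j} → j ∈ β G → 1 ≤ j × 0 < N G j × N G j ≤ δ
  ∈-β⁻ {G} {j} j∈β
    with ∈-filter⁻ (T? ∘ λ j → (0 <ᵇ N G j) ∧ (N G j ≤ᵇ δ)) {xs = range 1 n} j∈β
  ... | j∈range , t with Equivalence.to T-∧ t
  ... | pos , small = ∈-range⁻ {b = n} j∈range , <ᵇ⇒< 0 (N G j) pos , ≤ᵇ⇒≤ (N G j) δ small

  β-unique : ∀ G → Unique (β G)
  β-unique G = Unique.filter⁺ _ (range-unique n)

  μ≤count : ∀ {G i R} → Labels G i → (R? : Decidable R) →
            (∀ {j} → j ∈ β G → Pending G i j ⊆ R) → μ G ≤ count R? (allFin n)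
  μ≤count {G} {i} L R? pending⊆R = ≤-trans
    (sum-map-mono (β G) (λ j∈β →
      let (1≤j , 0<Nj , Nj≤δ) = ∈-β⁻ j∈β in deficit≤pending L 1≤j 0<Nj Nj≤δ))
    (sum-count-disjoint (pending? G i) (pending-disjoint L) R? (β G) (β-unique G)
                        pending⊆R (allFin n))

  unlabelled≤N₀ : ∀ {G i} → Labels G i → count (unlabelled? i) (allFin n) ≤ N G 0
  unlabelled≤N₀ {G} {i} L =
    count-mono (unlabelled? i) (λ x → G x ≟ 0) (unlabelled≡0 L _) (allFin n)

  μ≤N₀ : ∀ {G i} → Labels G i → μ G ≤ N G 0
  μ≤N₀ {i = i} L = ≤-trans (μ≤count L (unlabelled? i) (λ _ → proj₁)) (unlabelled≤N₀ L)

  0<μ⇒i<n : ∀ {G i} → Labels G i → 0 < μ G → i < n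
  0<μ⇒i<n {G} {i} L 0<μ =
    let (x , i≤x) = count-pos⇒∃ (unlabelled? i) (allFin n)
                      (≤-trans 0<μ (μ≤count L (unlabelled? i) (λ _ → proj₁)))
    in <-≤-trans (s≤s i≤x) (Fin.toℕ<n x)

  β≡∷⇒0<μ : ∀ {G j js} → β G ≡ j ∷ js → 0 < μ G
  β≡∷⇒0<μ {G} {j} β≡j∷js = subst (λ js → 0 < sum (map (deficit G) js)) (sym β≡j∷js)
    (≤-trans (m≤n+m 1 (δ ∸ N G j)) (m≤m+n _ _))

  next∉β⇒μ<N₀ : ∀ {G i} → Labels G i → (i<n : i < n) →
                ¬ Any (λ k → ClassOf G i k (fromℕ< i<n)) (β G) → μ G < N G 0
  next∉β⇒μ<N₀ {G} {i} L i<n none = begin-strict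
    μ G
      ≤⟨ μ≤count L R? pending⊆R ⟩
    count R? (allFin n)
      <⟨ m<m+n _ (∈⇒count-pos is-z? (∈-allFin z) refl) ⟩
    count R? (allFin n) + count is-z? (allFin n)
      ≤⟨ count-∪-disjoint R? is-z? (λ ((_ , ≢z) , ≡z) → ≢z ≡z) (allFin n) ⟩
    count (R? ∪? is-z?) (allFin n)
      ≤⟨ count-mono (R? ∪? is-z?) (unlabelled? i) R∪z⊆unlabelled (allFin n) ⟩
    count (unlabelled? i) (allFin n)
      ≤⟨ unlabelled≤N₀ L ⟩
    N G 0 ∎
    where
    open ≤-Reasoning
    z : Fin n
    z = fromℕ< i<n
    is-z? : Decidable (_≡ z)
    is-z? x = x Fin.≟ z
    R? : Decidable (Unlabelled i ∩ ∁ (_≡ z))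
    R? = unlabelled? i ∩? ∁? is-z?
    pending⊆R : ∀ {k} → k ∈ β G → Pending G i k ⊆ Unlabelled i ∩ ∁ (_≡ z)
    pending⊆R k∈β (i≤x , class) = i≤x , λ { refl → none (lose k∈β class) }
    R∪z⊆unlabelled : ∀ {x} → (Unlabelled i ∩ ∁ (_≡ z)) x ⊎ x ≡ z → Unlabelled i x
    R∪z⊆unlabelled (inj₁ (i≤x , _)) = i≤x
    R∪z⊆unlabelled (inj₂ refl)      = ≤-reflexive (sym (Fin.toℕ-fromℕ< i<n))

  μ≡N₀⇒next∈β : ∀ {G i j js} → Labels G i → μ G ≡ N G 0 → β G ≡ j ∷ js →
                Σ (i < n) λ i<n → ∃ λ k → k ∈ β G × ClassOf G i k (fromℕ< i<n)
  μ≡N₀⇒next∈β {G} {i} L μ≡N₀ β≡j∷js = i<n , find (decidable-stable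
      (Any.any? (λ k → classOf? G i k (fromℕ< i<n)) (β G))
      (λ none → <⇒≢ (next∉β⇒μ<N₀ L i<n none) μ≡N₀))
    where
    i<n : i < n
    i<n = 0<μ⇒i<n L (β≡∷⇒0<μ β≡j∷js)

  ContainsCopy : List (Mapping n) → Set
  ContainsCopy Gs = ∃ λ G → G ∈ Gs × Identical Γ G

  concatMap-copy : {A : Set} (f : A → List (Mapping n)) {k : A} {ks : List A} →
                   k ∈ ks → ContainsCopy (f k) → ContainsCopy (concatMap f ks)
  concatMap-copy f k∈ks (G , G∈fk , Γ≈G) = G , concatMap-∈ f k∈ks G∈fk , Γ≈G

  module Call (fuel : ℕ) (G₀ : Mapping n) (ρ i : ℕ) where

    G : Mapping n
    G = set G₀ i ρ

    child : ℕ → List (Mapping n)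
    child k = partition n fuel G k (suc i) δ

    step5 : List (Mapping n)
    step5 = concatMap child (range 1 (suc (maxLabel G)))

    step4 : List (Mapping n)
    step4 = if i ≡ᵇ n then G ∷ [] else step5

    step3 : List (Mapping n)
    step3 = if N G 0 <ᵇ μ G then [] else if μ G ≡ᵇ N G 0 then concatMap child (β G) else step4

    unfold-[] : β G ≡ [] → partition n (suc fuel) G₀ ρ i δ ≡ step4
    unfold-[] β≡[] with β G | β≡[]
    ... | .[] | refl = refl

    unfold-∷ : ∀ {j js} → β G ≡ j ∷ js → partition n (suc fuel) G₀ ρ i δ ≡ step3
    unfold-∷ {j} {js} β≡j∷js with β G | β≡j∷js
    ... | .(j ∷ js) | refl = refl

    module _ (i≤n : i ≤ n) (L : Labels G i)
             (child-copy : ∀ k → i < n → Labels (set G (suc i) k) (suc i) →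
                           ContainsCopy (child k)) where

      step5-copy : i < n → ContainsCopy step5
      step5-copy i<n with choose-label L (fromℕ< i<n)
      ... | k , 1≤k , k≤max+1 , correct =
        concatMap-copy child (∈-range⁺ 1≤k k≤max+1)
          (child-copy k i<n (labels-extend L (Fin.toℕ-fromℕ< i<n) 1≤k correct))

      step4-copy : ContainsCopy step4
      step4-copy = if-elim ContainsCopy (i ≡ᵇ n)
        (λ i≡n → G , here refl , labels⇒identical (subst (Labels G) (≡ᵇ⇒≡ i n i≡n) L))
        (λ i≢n → step5-copy (≤∧≢⇒< i≤n (i≢n ∘ ≡⇒≡ᵇ i n)))

      β-copy : μ G ≡ N G 0 → ∀ {j js} → β G ≡ j ∷ js → ContainsCopy (concatMap child (β G))
      β-copy μ≡N₀ β≡j∷js =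
        let (i<n , k , k∈β , class) = μ≡N₀⇒next∈β L μ≡N₀ β≡j∷js
            (1≤k , correct) = classOf⇒correct L class
        in concatMap-copy child k∈β
             (child-copy k i<n (labels-extend L (Fin.toℕ-fromℕ< i<n) 1≤k correct))

      step3-copy : ∀ {j js} → β G ≡ j ∷ js → ContainsCopy step3
      step3-copy β≡j∷js = if-elim ContainsCopy (N G 0 <ᵇ μ G)
        (λ N₀<μ → contradiction (μ≤N₀ L) (<⇒≱ (<ᵇ⇒< (N G 0) (μ G) N₀<μ)))
        (λ _ → if-elim ContainsCopy (μ G ≡ᵇ N G 0)
          (λ μ≡N₀ → β-copy (≡ᵇ⇒≡ (μ G) (N G 0) μ≡N₀) β≡j∷js)
          (λ _ → step4-copy))

      contains-copy : ∀ bs → β G ≡ bs → ContainsCopy (partition n (suc fuel) G₀ ρ i δ)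
      contains-copy []       β≡[]    = subst ContainsCopy (sym (unfold-[] β≡[])) step4-copy
      contains-copy (_ ∷ _) β≡j∷js =
        subst ContainsCopy (sym (unfold-∷ β≡j∷js)) (step3-copy β≡j∷js)

  partition-complete : ∀ fuel i G₀ ρ → i + fuel ≡ suc n → i ≤ n → Labels (set G₀ i ρ) i →
                       ContainsCopy (partition n fuel G₀ ρ i δ)
  partition-complete zero i _ _ i+0≡1+n i≤n _ =
    contradiction (subst (_≤ n) (trans (sym (+-identityʳ i)) i+0≡1+n) i≤n) 1+n≰n
  partition-complete (suc fuel) i G₀ ρ i+fuel≡1+n i≤n L =
    Call.contains-copy fuel G₀ ρ i i≤n L (λ k i<n →
      partition-complete fuel (suc i) (set G₀ i ρ) k (trans (sym (+-suc i fuel)) i+fuel≡1+n) i<n)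
    _ refl

proposition5 : (n δ : ℕ) → δ < n → (Γ : Mapping n) → IsδPartition δ Γ →
    ∃[ Γ' ] (Γ' ∈ reported n δ × Identical Γ Γ')
proposition5 n δ δ<n Γ Γ-δ =
  partition-complete n 1 Γ₀ 1 refl 0<n
    (labels-extend labels-∅ (Fin.toℕ-fromℕ< 0<n) (s≤s z≤n) (λ _ ()))
  where
  open Completeness n δ Γ Γ-δ
  0<n : 0 < n
  0<n = <-≤-trans (s≤s z≤n) δ<n
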